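{- Let $A$ be a real $2\times 2$ matrix, $B$ a real $1\times 2$ row vector, and $\mathrm{NT}=\{\vec{x}\in\mathbb{R}^2 : BA^k\vec{x}>0 \ \forall k\ge 0\}$. Suppose $A$ has a positive eigenvalue and a zero eigenvalue. If $\vec{\gamma}$ is an eigenvector of $A$ for the positive eigenvalue with $B\vec{\gamma}>0$, then $\mathrm{NT}=\{\vec{x}\in\mathbb{R}^2 : B\vec{x}>0,\ BA\vec{x}>0\}$.
   Context: $\mathrm{NT}$ is the non-termination set of the loop $\mathrm{while}\ (B\vec{x}>0)\ \{\vec{x}:=A\vec{x}\}$. -}

module Defs where

open import Level using (Level; _⊔_; suc)
open import Data.Fin using (Fin)
import Data.Fin as F
import Data.Nat as N
open import Data.Nat using (ℕ)
open import Data.Product using (Σ; ∃; _×_; _,_)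
open import Relation.Nullary using (¬_)
open import Relation.Binary.Structures using (IsStrictTotalOrder)
open import Algebra.Bundles using (CommutativeRing)

-- An ordered field (the stdlib has no real numbers; ℝ is an instance).
record OrderedField (c ℓ₁ ℓ₂ : Level) : Set (Level.suc (c ⊔ ℓ₁ ⊔ ℓ₂)) where
  field
    commutativeRing : CommutativeRing c ℓ₁
  open CommutativeRing commutativeRing public
  field
    _<_                : Carrier → Carrier → Set ℓ₂
    isStrictTotalOrder : IsStrictTotalOrder _≈_ _<_
    1≉0                : ¬ (1# ≈ 0#)
    inverse            : ∀ x → ¬ (x ≈ 0#) → ∃ λ y → x * y ≈ 1#
    +-mono-<           : ∀ {x y} z → x < y → (x + z) < (y + z)
    *-pos              : ∀ {x y} → 0# < x → 0# < y → 0# < (x * y)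
  infix 4 _<_

module _ {c ℓ₁ ℓ₂} (𝔽 : OrderedField c ℓ₁ ℓ₂) where
  open OrderedField 𝔽 hiding (zero)

  i₀ i₁ : Fin 2
  i₀ = F.zero
  i₁ = F.suc F.zero

  Vec2 : Set c
  Vec2 = Fin 2 → Carrier

  Mat2 : Set c
  Mat2 = Fin 2 → Fin 2 → Carrier

  Row2 : Set c
  Row2 = Fin 2 → Carrier

  mulMV : Mat2 → Vec2 → Vec2
  mulMV A x i = A i i₀ * x i₀ + A i i₁ * x i₁

  powMV : Mat2 → ℕ → Vec2 → Vec2
  powMV A N.zero    x = x
  powMV A (N.suc k) x = mulMV A (powMV A k x)

  rowMul : Row2 → Vec2 → Carrier
  rowMul B x = B i₀ * x i₀ + B i₁ * x i₁

  IsZeroVec : Vec2 → Set ℓ₁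
  IsZeroVec v = ∀ i → v i ≈ 0#

  IsEigenvector : Mat2 → Carrier → Vec2 → Set ℓ₁
  IsEigenvector A λ' v = ¬ IsZeroVec v × (∀ i → mulMV A v i ≈ λ' * v i)

  IsEigenvalue : Mat2 → Carrier → Set (c ⊔ ℓ₁)
  IsEigenvalue A λ' = ∃ λ v → IsEigenvector A λ' v

  -- non-termination set of  while (B x > 0) { x := A x }
  NT : Mat2 → Row2 → Vec2 → Set ℓ₂
  NT A B x = ∀ (k : ℕ) → 0# < rowMul B (powMV A k x)

module Submission where

-- For the 2×2 matrix A = (a b; c d) write tr A = a + d.
-- The Cayley–Hamilton identity, in subtraction-free form
--   A²v + (a d)·v = (tr A)·Av + (b c)·v,
-- shows that every eigenvalue t of A satisfies  t² + a d = (tr A)·t + b c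
-- (an eigenvector is nonzero, so scalars can be compared on one of its
-- nonzero entries).  The eigenvalue 0 therefore forces a d = b c, i.e.
-- A is singular, and then the positive eigenvalue λ satisfies
-- λ² = (tr A)·λ, i.e. λ = tr A.  Cayley–Hamilton now reads A²v = λ·Av,
-- so the sequence  B A^(k+1) x  is multiplied by λ > 0 at each step and
-- stays positive as soon as  B A x > 0.  Hence x ∈ NT iff B x > 0 and
-- B A x > 0; the forward direction is the cases k = 0, 1 of NT.

open import Defs
open import Data.Nat using (zero; suc)
open import Data.Product using (_×_; _,_; ∃)
import Data.Fin as Fin
open import Relation.Nullary using (¬_; yes; no)
open import Relation.Binary.Structures using (IsStrictTotalOrder)
open import Data.Empty using (⊥-elim)

module TwoByTwo {c ℓ₁ ℓ₂} (F : OrderedField c ℓ₁ ℓ₂) where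
  open OrderedField F hiding (zero)
  open IsStrictTotalOrder isStrictTotalOrder using (_≟_; <-respʳ-≈)
  open import Algebra.Solver.Ring.NaturalCoefficients.Default commutativeSemiring
    using (solve; _:+_; _:*_; _:=_)
  open import Algebra.Properties.Group +-group using () renaming (∙-cancelʳ to +-cancelʳ)
  open import Relation.Binary.Reasoning.Setoid setoid

  nonzero-cancelˡ : ∀ {l x y} → ¬ (l ≈ 0#) → l * x ≈ l * y → x ≈ y
  nonzero-cancelˡ {l} {x} {y} l≉0 lx≈ly with inverse l l≉0
  ... | l⁻¹ , ll⁻¹≈1 = begin
    x              ≈⟨ undo x ⟩
    l⁻¹ * (l * x)  ≈⟨ *-cong refl lx≈ly ⟩
    l⁻¹ * (l * y)  ≈⟨ sym (undo y) ⟩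
    y              ∎
    where
    undo : ∀ z → z ≈ l⁻¹ * (l * z)
    undo z = begin
      z              ≈⟨ sym (*-identityˡ z) ⟩
      1# * z         ≈⟨ *-cong (trans (sym ll⁻¹≈1) (*-comm l l⁻¹)) refl ⟩
      (l⁻¹ * l) * z  ≈⟨ *-assoc l⁻¹ l z ⟩
      l⁻¹ * (l * z)  ∎

  -- A vector that is not the zero vector has a nonzero entry (equality
  -- in an ordered field is decidable by trichotomy).
  nonzero-entry : (v : Vec2 F) → ¬ IsZeroVec F v → ∃ λ i → ¬ (v i ≈ 0#)
  nonzero-entry v v≢0 with v (i₀ F) ≟ 0# | v (i₁ F) ≟ 0#
  ... | no v₀≉0  | _        = i₀ F , v₀≉0
  ... | yes _    | no v₁≉0  = i₁ F , v₁≉0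
  ... | yes v₀≈0 | yes v₁≈0 = ⊥-elim (v≢0 λ { Fin.zero → v₀≈0 ; (Fin.suc Fin.zero) → v₁≈0 })

  scalars-agree-on-nonzero : ∀ {p q} (v : Vec2 F) → ¬ IsZeroVec F v →
                             (∀ i → p * v i ≈ q * v i) → p ≈ q
  scalars-agree-on-nonzero {p} {q} v v≢0 pv≈qv with nonzero-entry v v≢0
  ... | i , vᵢ≉0 = nonzero-cancelˡ vᵢ≉0 (trans (*-comm (v i) p) (trans (pv≈qv i) (*-comm q (v i))))

  -- Linearity.  Each entry of A v, and B v itself, is a combination
  -- p·x + q·y of the entries of v, so both maps respect scaling.
  combination-scaled : ∀ p q s {x y x′ y′} → x ≈ s * x′ → y ≈ s * y′ →
                       p * x + q * y ≈ s * (p * x′ + q * y′)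
  combination-scaled p q s {x} {y} {x′} {y′} x≈sx′ y≈sy′ = begin
    p * x + q * y               ≈⟨ +-cong (*-cong refl x≈sx′) (*-cong refl y≈sy′) ⟩
    p * (s * x′) + q * (s * y′) ≈⟨ solve 5 (λ p q s x y → p :* (s :* x) :+ q :* (s :* y)
                                              := s :* (p :* x :+ q :* y)) refl p q s x′ y′ ⟩
    s * (p * x′ + q * y′)       ∎

  mulMV-scaled : ∀ (A : Mat2 F) s {v w : Vec2 F} → (∀ j → v j ≈ s * w j) →
                 ∀ i → mulMV F A v i ≈ s * mulMV F A w i
  mulMV-scaled A s v≈sw i = combination-scaled _ _ s (v≈sw (i₀ F)) (v≈sw (i₁ F))

  rowMul-scaled : ∀ (B : Row2 F) s {v w : Vec2 F} → (∀ j → v j ≈ s * w j) →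
                  rowMul F B v ≈ s * rowMul F B w
  rowMul-scaled B s v≈sw = combination-scaled _ _ s (v≈sw (i₀ F)) (v≈sw (i₁ F))

  module Matrix (A : Mat2 F) where
    private
      a b c′ d : Carrier
      a  = A (i₀ F) (i₀ F)
      b  = A (i₀ F) (i₁ F)
      c′ = A (i₁ F) (i₀ F)
      d  = A (i₁ F) (i₁ F)

    tr : Carrier
    tr = a + d

    Singular : Set ℓ₁
    Singular = a * d ≈ b * c′

    cayley-hamilton : ∀ v i →
      mulMV F A (mulMV F A v) i + (a * d) * v i ≈ tr * mulMV F A v i + (b * c′) * v i
    cayley-hamilton v Fin.zero = solve 6
      (λ a b c d x y → a :* (a :* x :+ b :* y) :+ b :* (c :* x :+ d :* y) :+ a :* d :* x
                       := (a :+ d) :* (a :* x :+ b :* y) :+ b :* c :* x)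
      refl a b c′ d (v (i₀ F)) (v (i₁ F))
    cayley-hamilton v (Fin.suc Fin.zero) = solve 6
      (λ a b c d x y → c :* (a :* x :+ b :* y) :+ d :* (c :* x :+ d :* y) :+ a :* d :* y
                       := (a :+ d) :* (c :* x :+ d :* y) :+ b :* c :* y)
      refl a b c′ d (v (i₀ F)) (v (i₁ F))

    -- Every eigenvalue t is a root of the characteristic polynomial:
    -- apply Cayley–Hamilton to an eigenvector v, where A²v = t²v and
    -- Av = tv, and compare scalars on the nonzero vector v.
    characteristic-equation : ∀ {t} → IsEigenvalue F A t →
                              t * t + a * d ≈ tr * t + b * c′
    characteristic-equation {t} (v , v≢0 , Av≈tv) = scalars-agree-on-nonzero v v≢0 λ i → begin
      (t * t + a * d) * v i
        ≈⟨ solve 3 (λ t p x → (t :* t :+ p) :* x := t :* (t :* x) :+ p :* x) refl t (a * d) (v i) ⟩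
      t * (t * v i) + (a * d) * v i
        ≈⟨ +-cong (sym (A²v≈t²v i)) refl ⟩
      mulMV F A (mulMV F A v) i + (a * d) * v i
        ≈⟨ cayley-hamilton v i ⟩
      tr * mulMV F A v i + (b * c′) * v i
        ≈⟨ +-cong (*-cong refl (Av≈tv i)) refl ⟩
      tr * (t * v i) + (b * c′) * v i
        ≈⟨ solve 4 (λ r t q x → r :* (t :* x) :+ q :* x := (r :* t :+ q) :* x) refl tr t (b * c′) (v i) ⟩
      (tr * t + b * c′) * v i ∎
      where
      A²v≈t²v : ∀ i → mulMV F A (mulMV F A v) i ≈ t * (t * v i)
      A²v≈t²v i = trans (mulMV-scaled A t Av≈tv i) (*-cong refl (Av≈tv i))

    eigenvalue-zero⇒singular : IsEigenvalue F A 0# → Singular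
    eigenvalue-zero⇒singular ev = begin
      a * d                 ≈⟨ sym (+-identityˡ (a * d)) ⟩
      0# + a * d            ≈⟨ +-cong (sym (zeroˡ 0#)) refl ⟩
      0# * 0# + a * d       ≈⟨ characteristic-equation ev ⟩
      tr * 0# + b * c′      ≈⟨ +-cong (zeroʳ tr) refl ⟩
      0# + b * c′           ≈⟨ +-identityˡ (b * c′) ⟩
      b * c′                ∎

    singular⇒square : Singular → ∀ v i → mulMV F A (mulMV F A v) i ≈ tr * mulMV F A v i
    singular⇒square singular v i = +-cancelʳ ((b * c′) * v i) _ _ (begin
      mulMV F A (mulMV F A v) i + (b * c′) * v i ≈⟨ +-cong refl (*-cong (sym singular) refl) ⟩
      mulMV F A (mulMV F A v) i + (a * d) * v i  ≈⟨ cayley-hamilton v i ⟩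
      tr * mulMV F A v i + (b * c′) * v i       ∎)

    -- The nonzero eigenvalue of a singular matrix is its trace:
    -- t² = (tr A)·t, and t can be cancelled.
    singular⇒eigenvalue≈tr : ∀ {t} → Singular → ¬ (t ≈ 0#) → IsEigenvalue F A t → t ≈ tr
    singular⇒eigenvalue≈tr {t} singular t≉0 ev =
      nonzero-cancelˡ t≉0 (+-cancelʳ (b * c′) _ _ (begin
        t * t + b * c′   ≈⟨ +-cong refl (sym singular) ⟩
        t * t + a * d    ≈⟨ characteristic-equation ev ⟩
        tr * t + b * c′  ≈⟨ +-cong (*-comm tr t) refl ⟩
        t * tr + b * c′  ∎))

  open Matrix public

  orbit-positive : ∀ (A : Mat2 F) (B : Row2 F) {t} x → 0# < t →
    (∀ y → rowMul F B (mulMV F A (mulMV F A y)) ≈ t * rowMul F B (mulMV F A y)) →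
    0# < rowMul F B (mulMV F A x) → ∀ k → 0# < rowMul F B (powMV F A (suc k) x)
  orbit-positive A B x t>0 step BAx>0 zero    = BAx>0
  orbit-positive A B x t>0 step BAx>0 (suc k) =
    <-respʳ-≈ (sym (step (powMV F A k x))) (*-pos t>0 (orbit-positive A B x t>0 step BAx>0 k))

lemma6 : ∀ {c ℓ₁ ℓ₂} (F : OrderedField c ℓ₁ ℓ₂) →
    let open OrderedField F in
    (A : Mat2 F) (B : Row2 F) (λ₊ : Carrier) →
    0# < λ₊ → IsEigenvalue F A λ₊ → IsEigenvalue F A 0# →
    (γ : Vec2 F) → IsEigenvector F A λ₊ γ → 0# < rowMul F B γ →
    ∀ (x : Vec2 F) →
    (NT F A B x → (0# < rowMul F B x) × (0# < rowMul F B (mulMV F A x)))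
    × ((0# < rowMul F B x) × (0# < rowMul F B (mulMV F A x)) → NT F A B x)
lemma6 F A B λ₊ λ₊>0 λ₊-eigen 0-eigen _ _ _ x = (λ nt → nt 0 , nt 1) , sufficient
  where
  open OrderedField F hiding (zero)
  open IsStrictTotalOrder isStrictTotalOrder using (irrefl)
  open TwoByTwo F

  singular : Singular A
  singular = eigenvalue-zero⇒singular A 0-eigen

  λ₊≈tr : λ₊ ≈ tr A
  λ₊≈tr = singular⇒eigenvalue≈tr A singular (λ λ₊≈0 → irrefl (sym λ₊≈0) λ₊>0) λ₊-eigen

  -- B A²y = λ₊·(B A y), since A² = (tr A)·A = λ₊·A.
  step : ∀ y → rowMul F B (mulMV F A (mulMV F A y)) ≈ λ₊ * rowMul F B (mulMV F A y)
  step y = rowMul-scaled B λ₊ (λ i → trans (singular⇒square A singular y i) (*-cong (sym λ₊≈tr) refl))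

  sufficient : (0# < rowMul F B x) × (0# < rowMul F B (mulMV F A x)) → NT F A B x
  sufficient (Bx>0 , _)     zero    = Bx>0
  sufficient (_    , BAx>0) (suc k) = orbit-positive A B x λ₊>0 step BAx>0 k
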